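{- Let $r\ge 2$, let $k$ be an integer with $0\le k\le r-1$, and let $G$ be a finite $(r+1)$-partite $r$-graph in which every partite $(r-1)$-tuple of vertices has strictly balanced degree. If $\rho(i)>1-\frac{k+1}{r}$ for all $i\in\{1,\ldots,r+1\}$, then $G$ contains a copy of $K_{r+1}^r-k$.
   Context: An $r$-graph is an $r$-uniform hypergraph (unweighted). It is $(r+1)$-partite with classes $V_1,\ldots,V_{r+1}$ if every edge has at most one vertex in each class. $P_i$ is the $r$-partite $r$-graph induced by the classes $V_j$, $j\ne i$, and $\rho(i)=|E(P_i)|/\prod_{j\ne i}|V_j|$. A set of vertices is partite if it has at most one vertex in each class. For a partite $(r-1)$-tuple $g$ and a class $V_i$ not meeting $g$, $d(V_i,g)$ is the number of $v\in V_i$ with $g\cup\{v\}\in E(G)$; $g$ has strictly balanced degree if $d(V_i,g)=d(V_j,g)$ for the two classes $V_i,V_j$ not meeting $g$. $K_{r+1}^r-k$ is the $r$-graph obtained from the complete $r$-graph $K_{r+1}^r$ on $r+1$ vertices by deleting any $k$ of its edges. -}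

module Defs where

open import Data.Nat using (ℕ; zero; suc; _+_; _*_; _∸_)
open import Data.Bool using (Bool; true; false; T)
open import Data.Fin using (Fin; zero; suc)
open import Data.Fin.Properties using (_≟_)
open import Data.Fin.Subset using (Subset; _∈_; _∉_; _∪_; ⁅_⁆; ∣_∣; ⋃)
open import Data.Fin.Subset.Properties using (_∈?_)
open import Data.List using (List; []; _∷_; map; filter; length; allFin; _++_)
open import Data.Vec using (Vec; []; _∷_; tabulate)
open import Data.Product using (Σ; _×_; _,_)
open import Relation.Binary.PropositionalEquality using (_≡_; _≢_)
open import Relation.Nullary using (¬_; ¬?; Dec; yes; no)
open import Relation.Nullary.Decidable using (does)
open import Function using (_∘_)
open import Data.Nat.ListAction using (product)

countFin : (N : ℕ) → (Fin N → Bool) → ℕ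
countFin zero    p = 0
countFin (suc N) p with p zero
... | true  = suc (countFin N (p ∘ suc))
... | false = countFin N (p ∘ suc)

allSubsets : (n : ℕ) → List (Subset n)
allSubsets zero    = [] ∷ []
allSubsets (suc n) = map (true ∷_) (allSubsets n) ++ map (false ∷_) (allSubsets n)

-- A finite (r+1)-partite r-graph: vertex set Fin N, vertex classes
-- V_1..V_{r+1} given by cls, edge set given by a Boolean predicate on
-- subsets of vertices.
record PartiteGraph (r : ℕ) : Set where
  field
    N        : ℕ
    cls      : Fin N → Fin (suc r)
    edge     : Subset N → Bool
    uniform  : ∀ S → T (edge S) → ∣ S ∣ ≡ r
    partite  : ∀ S → T (edge S) → ∀ x y → x ∈ S → y ∈ S → cls x ≡ cls y → x ≡ y

module _ {r : ℕ} (G : PartiteGraph r) where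
  open PartiteGraph G

  inClass : Fin (suc r) → Fin N → Bool
  inClass i v = does (cls v ≟ i)

  classSize : Fin (suc r) → ℕ
  classSize i = countFin N (inClass i)

  avoids : Fin (suc r) → Subset N → Bool
  avoids i S = countFin N (λ v → does (v ∈? S) Data.Bool.∧ inClass i v) Data.Nat.≡ᵇ 0

  -- |E(P_i)| : the number of edges of the r-partite r-graph induced by the
  -- classes V_j, j ≠ i (= edges with no vertex in V_i)
  edgesP : Fin (suc r) → ℕ
  edgesP i = length (filter (λ S → T? (edge S Data.Bool.∧ avoids i S)) (allSubsets N))
    where open import Relation.Nullary.Decidable using () renaming (T? to T?)

  prodOthers : Fin (suc r) → ℕ
  prodOthers i = product (map classSize (filter (λ j → ¬? (j ≟ i)) (allFin (suc r))))

  IsPartite : Subset N → Set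
  IsPartite g = ∀ x y → x ∈ g → y ∈ g → cls x ≡ cls y → x ≡ y

  PartiteTuple : Subset N → Set
  PartiteTuple g = ∣ g ∣ ≡ r ∸ 1 × IsPartite g

  ClassMisses : Fin (suc r) → Subset N → Set
  ClassMisses i g = ∀ v → v ∈ g → cls v ≢ i

  deg : Fin (suc r) → Subset N → ℕ
  deg i g = countFin N (λ v → inClass i v Data.Bool.∧ edge (g ∪ ⁅ v ⁆))

  StrictlyBalanced : Subset N → Set
  StrictlyBalanced g = ∀ i j → i ≢ j → ClassMisses i g → ClassMisses j g → deg i g ≡ deg j g

  AllBalanced : Set
  AllBalanced = ∀ g → PartiteTuple g → StrictlyBalanced g

  imageMinus : (Fin (suc r) → Fin N) → Fin (suc r) → Subset N
  imageMinus φ m = ⋃ (map (λ y → ⁅ φ y ⁆) (filter (λ y → ¬? (y ≟ m)) (allFin (suc r))))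

  -- G contains a copy of K_{r+1}^r - k: there are r+1 distinct vertices
  -- φ(0..r) and a set M of exactly k of the r+1 r-subsets of {φ(0..r)}
  -- (indexed by the omitted vertex) such that every r-subset not in M is
  -- an edge of G.
  ContainsKminus : ℕ → Set
  ContainsKminus k =
    Σ (Fin (suc r) → Fin N) λ φ →
      (∀ x y → φ x ≡ φ y → x ≡ y) ×
      Σ (Subset (suc r)) λ M → (∣ M ∣ ≡ k) × (∀ m → m ∉ M → T (edge (imageMinus φ m)))

module Submission where

open import Defs
open import Data.Nat using (ℕ; zero; suc; _+_; _*_; _∸_; _≤_; _<_; z≤n; s≤s; _≤?_; >-nonZero)
open import Data.Nat.Properties
open import Data.Bool using (Bool; true; false; T; _∧_; not; if_then_else_)
open import Data.Fin using (Fin; zero; suc)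
open import Data.Product using (Σ; _×_; _,_; proj₁; proj₂)
open import Data.Sum using (_⊎_; inj₁; inj₂)
open import Relation.Binary.PropositionalEquality
open import Relation.Nullary using (Dec; yes; no; ¬_; ¬?; contradiction)
open import Relation.Nullary.Decidable using (does; dec-true; _×-dec_; T?)
open import Function.Bundles using (Equivalence)
open import Data.Empty using (⊥; ⊥-elim)
open import Function using (_∘_)
open import Data.List using (List; []; _∷_; map; filter; length; allFin; _++_)
import Data.List as List
open import Data.Nat.ListAction using (product)
open import Data.List.Relation.Unary.Any using (here; there)
import Data.List.Membership.Propositional as List
open import Data.List.Membership.Propositional.Properties using (∈-filter⁺; ∈-filter⁻; ∈-allFin)
open import Data.Vec using (Vec; []; _∷_; here; there; lookup; _[_]≔_)
import Data.Vec as Vec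
import Data.Vec.Properties as Vec
import Data.Bool.Properties as Bool
open import Data.Fin.Subset using (Subset; _∈_; _∉_; _∪_; ⁅_⁆; ∣_∣; ⋃; inside; outside)
open import Data.Fin.Subset.Properties using (_∈?_; ⊆-antisym; x∈p∪q⁻; x∈p∪q⁺; x∈⁅x⁆; x∈⁅y⁆⇒x≡y; ∉⊥)
open import Algebra.Properties.Semiring.Sum +-*-semiring
  using (sum; sum-syntax; sum-cong-≗; ∑-distrib-+; ∑-comm; *-distribˡ-sum; *-distribʳ-sum)
open import Data.Nat.Tactic.RingSolver using (solve-∀)
open import Algebra.Properties.CommutativeSemigroup *-commutativeSemigroup using (x∙yz≈y∙xz)
import Data.Fin.Properties as Fin

-- Consider the transversals T = (T_0,…,T_r) with T_i ∈ V_i: Π is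
-- their number, e_i(T) ∈ {0,1} says whether the face T ∖ {T_i} is an edge,
-- and A_i = Σ_T e_i(T).  If some transversal has at least r + 1 - k edge
-- faces, its non-edge faces, padded to exactly k, are the deleted edges of
-- a copy.  Otherwise every T has at most c + 1 edge faces, c = r - (k+1).
-- For i ≠ j, balance of the (r-1)-tuple T ∖ {T_i, T_j} and Cauchy–Schwarz
-- give A_i A_j ≤ Π · Σ_T e_i(T) e_j(T); summing over j ≠ i with the face
-- bound yields Σ_j A_j ≤ A_i + cΠ, and summing over i contradicts
-- cΠ < r A_i, which is the density hypothesis since Π = n_i ∏_{j≠i} n_j
-- and |E(P_i)| n_i ≤ A_i.

⟦_⟧ : Bool → ℕ
⟦ true ⟧ = 1
⟦ false ⟧ = 0

⟦⟧≤1 : ∀ b → ⟦ b ⟧ ≤ 1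
⟦⟧≤1 true = ≤-refl
⟦⟧≤1 false = z≤n

⟦∧⟧ : ∀ a b → ⟦ a ∧ b ⟧ ≡ ⟦ a ⟧ * ⟦ b ⟧
⟦∧⟧ true b = sym (*-identityˡ ⟦ b ⟧)
⟦∧⟧ false b = refl

⟦not⟧ : ∀ b → ⟦ not b ⟧ + ⟦ b ⟧ ≡ 1
⟦not⟧ true = refl
⟦not⟧ false = refl

∧-split : ∀ {a b} → a ∧ b ≡ true → a ≡ true × b ≡ true
∧-split {true} {true} _ = refl , refl

does-true : ∀ {P : Set} (d : Dec P) → does d ≡ true → P
does-true (yes p) _ = p

sum-mono : ∀ {n} {f g : Fin n → ℕ} → (∀ x → f x ≤ g x) → sum f ≤ sum g
sum-mono {zero} le = z≤n
sum-mono {suc n} le = +-mono-≤ (le zero) (sum-mono (le ∘ suc))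

sum-strict : ∀ {n} {f g : Fin (suc n) → ℕ} → (∀ x → f x < g x) → sum f < sum g
sum-strict lt = +-mono-<-≤ (lt zero) (sum-mono (<⇒≤ ∘ lt ∘ suc))

sum-scale : ∀ {n} k (f : Fin n → ℕ) → ∑[ x < n ] (k * f x) ≡ k * sum f
sum-scale k f = sym (*-distribˡ-sum k f)

sum-const : ∀ n k → ∑[ x < n ] k ≡ n * k
sum-const zero k = refl
sum-const (suc n) k = cong (k +_) (sum-const n k)

sum-pick : ∀ {n} (u : Fin n) (f : Fin n → ℕ) → ∑[ x < n ] (⟦ does (x Fin.≟ u) ⟧ * f x) ≡ f u
sum-pick {suc n} zero f = begin
  f zero + 0 + ∑[ x < n ] 0 ≡⟨ cong₂ _+_ (+-identityʳ (f zero)) (sum-const n 0) ⟩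
  f zero + n * 0            ≡⟨ cong (f zero +_) (*-zeroʳ n) ⟩
  f zero + 0                ≡⟨ +-identityʳ (f zero) ⟩
  f zero                    ∎
  where open ≡-Reasoning
sum-pick {suc n} (suc u) f = sum-pick u (f ∘ suc)

sum-split : ∀ {n} (i : Fin n) (f : Fin n → ℕ) →
  sum f ≡ f i + ∑[ j < n ] (⟦ not (does (j Fin.≟ i)) ⟧ * f j)
sum-split {n} i f = begin
  sum f                                              ≡⟨ sum-cong-≗ split ⟩
  ∑[ j < n ] (⟦ does (j Fin.≟ i) ⟧ * f j + ⟦ not (does (j Fin.≟ i)) ⟧ * f j)
                                                     ≡⟨ ∑-distrib-+ (λ j → ⟦ does (j Fin.≟ i) ⟧ * f j) (λ j → ⟦ not (does (j Fin.≟ i)) ⟧ * f j) ⟩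
  ∑[ j < n ] (⟦ does (j Fin.≟ i) ⟧ * f j) + rest      ≡⟨ cong (_+ rest) (sum-pick i f) ⟩
  f i + rest                                         ∎
  where
  open ≡-Reasoning
  rest : ℕ
  rest = ∑[ j < n ] (⟦ not (does (j Fin.≟ i)) ⟧ * f j)
  split : ∀ j → f j ≡ ⟦ does (j Fin.≟ i) ⟧ * f j + ⟦ not (does (j Fin.≟ i)) ⟧ * f j
  split j with does (j Fin.≟ i)
  ... | true = sym (trans (+-identityʳ _) (+-identityʳ _))
  ... | false = sym (+-identityʳ _)

sum-point : ∀ {n} (u : Fin n) → ∑[ x < n ] ⟦ does (u Fin.≟ x) ⟧ ≡ 1
sum-point {suc n} zero = cong suc (trans (sum-const n 0) (*-zeroʳ n))
sum-point {suc n} (suc u) = sum-point u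

except-two : ∀ {n} (i j : Fin n) → i ≢ j → ∑[ l < n ] ⟦ not (does (i Fin.≟ l)) ∧ not (does (j Fin.≟ l)) ⟧ + 2 ≡ n
except-two {n} i j i≢j = begin
  sum out + 2                                   ≡⟨ cong (sum out +_) (sym (cong₂ _+_ (sum-point i) (sum-point j))) ⟩
  sum out + (sum isI + sum isJ)                 ≡⟨ cong (sum out +_) (sym (∑-distrib-+ isI isJ)) ⟩
  sum out + ∑[ l < n ] (isI l + isJ l)          ≡⟨ sym (∑-distrib-+ out (λ l → isI l + isJ l)) ⟩
  ∑[ l < n ] (out l + (isI l + isJ l))          ≡⟨ sum-cong-≗ partition ⟩
  ∑[ l < n ] 1                                  ≡⟨ trans (sum-const n 1) (*-identityʳ n) ⟩
  n                                             ∎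
  where
  open ≡-Reasoning
  isI isJ out : Fin n → ℕ
  isI l = ⟦ does (i Fin.≟ l) ⟧
  isJ l = ⟦ does (j Fin.≟ l) ⟧
  out l = ⟦ not (does (i Fin.≟ l)) ∧ not (does (j Fin.≟ l)) ⟧
  partition : ∀ l → out l + (isI l + isJ l) ≡ 1
  partition l with i Fin.≟ l | j Fin.≟ l
  ... | yes refl | yes refl = ⊥-elim (i≢j refl)
  ... | yes _ | no _ = refl
  ... | no _ | yes _ = refl
  ... | no _ | no _ = refl

prod : ∀ {n} → (Fin n → ℕ) → ℕ
prod {zero} f = 1
prod {suc n} f = f zero * prod (f ∘ suc)

product-filter : ∀ {R m} (h : Fin m → Fin R) (f : Fin R → ℕ) i →
  product (map f (filter (λ j → ¬? (j Fin.≟ i)) (List.tabulate h)))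
    ≡ prod (λ p → if does (h p Fin.≟ i) then 1 else f (h p))
product-filter {m = zero} h f i = refl
product-filter {m = suc m} h f i with h zero Fin.≟ i
... | yes _ = trans (product-filter (h ∘ suc) f i) (sym (*-identityˡ _))
... | no _ = cong (f (h zero) *_) (product-filter (h ∘ suc) f i)

prod-except : ∀ {m} (f : Fin m → ℕ) i → prod (λ p → if does (p Fin.≟ i) then 1 else f p) * f i ≡ prod f
prod-except {suc m} f zero = trans (cong (_* f zero) (*-identityˡ (prod (f ∘ suc)))) (*-comm _ (f zero))
prod-except {suc m} f (suc i) = trans (*-assoc (f zero) _ (f (suc i))) (cong (f zero *_) (prod-except (f ∘ suc) i))

count-sum : ∀ n (p : Fin n → Bool) → countFin n p ≡ ∑[ x < n ] ⟦ p x ⟧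
count-sum zero p = refl
count-sum (suc n) p with p zero
... | true = cong suc (count-sum n (p ∘ suc))
... | false = count-sum n (p ∘ suc)

another : ∀ {m} → 2 ≤ m → (i : Fin m) → Σ (Fin m) λ j → i ≢ j
another (s≤s (s≤s _)) zero = suc zero , λ ()
another (s≤s (s≤s _)) (suc _) = zero , λ ()

count-none : ∀ n (p : Fin n → Bool) → (∀ x → p x ≡ false) → countFin n p ≡ 0
count-none zero p none = refl
count-none (suc n) p none with p zero | none zero
... | false | _ = count-none n (p ∘ suc) (none ∘ suc)

count-witness : ∀ n (p : Fin n → Bool) x → p x ≡ true → 1 ≤ countFin n p
count-witness (suc n) p x px with p zero in p0
... | true = s≤s z≤n
count-witness (suc n) p zero px | false = ⊥-elim (false≢true (trans (sym p0) px))
  where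
  false≢true : false ≢ true
  false≢true ()
count-witness (suc n) p (suc x) px | false = count-witness n (p ∘ suc) x px

count-positive : ∀ n (p : Fin n → Bool) → 1 ≤ countFin n p → Σ (Fin n) λ x → p x ≡ true
count-positive (suc n) p pos with p zero in p0
... | true = zero , p0
... | false with count-positive n (p ∘ suc) pos
...   | x , px = suc x , px

count-unique : ∀ n (p : Fin n → Bool) → (∀ x y → p x ≡ true → p y ≡ true → x ≡ y) → countFin n p ≤ 1
count-unique zero p unique = z≤n
count-unique (suc n) p unique with p zero in p0
... | true = s≤s (≤-reflexive (count-none n (p ∘ suc) others))
  where
  others : ∀ x → p (suc x) ≡ false
  others x with p (suc x) in px
  ... | false = refl
  ... | true with unique zero (suc x) p0 px
  ...   | ()
... | false = count-unique n (p ∘ suc) (λ x y px py → Fin.suc-injective (unique (suc x) (suc y) px py))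

positive-factor : ∀ {a b x} → a < b * x → 0 < x
positive-factor {a} {b} {zero} lt = contradiction (subst (a <_) (*-zeroʳ b) lt) λ ()
positive-factor {x = suc x} _ = s≤s z≤n

∸-split-one : ∀ {r k} → k < r → r ∸ k ≡ suc (r ∸ (k + 1))
∸-split-one {suc r} {zero} _ = refl
∸-split-one {suc r} {suc k} (s≤s k<r) = ∸-split-one k<r

2ab≤a²+b²-ordered : ∀ a b → a ≤ b → 2 * (a * b) ≤ a * a + b * b
2ab≤a²+b²-ordered a b a≤b with m≤n⇒∃[o]m+o≡n a≤b
... | d , refl = subst₂ _≤_ (sym (lhs a d)) (sym (rhs a d)) (m≤m+n _ (d * d))
  where
  lhs : ∀ a d → 2 * (a * (a + d)) ≡ 2 * (a * a) + 2 * (a * d)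
  lhs = solve-∀
  rhs : ∀ a d → a * a + (a + d) * (a + d) ≡ 2 * (a * a) + 2 * (a * d) + d * d
  rhs = solve-∀

2ab≤a²+b² : ∀ a b → 2 * (a * b) ≤ a * a + b * b
2ab≤a²+b² a b with ≤-total a b
... | inj₁ a≤b = 2ab≤a²+b²-ordered a b a≤b
... | inj₂ b≤a = subst₂ _≤_ (cong (2 *_) (*-comm b a)) (+-comm (b * b) (a * a)) (2ab≤a²+b²-ordered b a b≤a)

listSum : ∀ {A : Set} → List A → (A → ℕ) → ℕ
listSum [] f = 0
listSum (x ∷ xs) f = f x + listSum xs f

-- A positive linear functional on ℕ-valued functions: additive,
-- homogeneous and monotone.  Sums over lists and over tuples of vertices
-- are of this kind.
record PositiveLinear {X : Set} (Φ : (X → ℕ) → ℕ) : Set where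
  field
    Φ-cong  : ∀ {f g} → (∀ x → f x ≡ g x) → Φ f ≡ Φ g
    Φ-mono  : ∀ {f g} → (∀ x → f x ≤ g x) → Φ f ≤ Φ g
    Φ-+     : ∀ f g → Φ (λ x → f x + g x) ≡ Φ f + Φ g
    Φ-scale : ∀ k f → Φ (λ x → k * f x) ≡ k * Φ f

module PositiveLinearProperties {X : Set} {Φ : (X → ℕ) → ℕ} (L : PositiveLinear Φ) where
  open PositiveLinear L

  Φ-zero : Φ (λ _ → 0) ≡ 0
  Φ-zero = Φ-scale 0 (λ _ → 0)

  Φ-const : ∀ k → Φ (λ _ → k) ≡ k * Φ (λ _ → 1)
  Φ-const k = trans (Φ-cong (λ _ → sym (*-identityʳ k))) (Φ-scale k (λ _ → 1))

  Φ-∑ : ∀ n (f : Fin n → X → ℕ) → Φ (λ y → ∑[ x < n ] f x y) ≡ ∑[ x < n ] Φ (f x)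
  Φ-∑ zero f = Φ-zero
  Φ-∑ (suc n) f = trans (Φ-+ (f zero) _) (cong (Φ (f zero) +_) (Φ-∑ n (f ∘ suc)))

  Φ-listSum : ∀ {A : Set} (L : List A) (f : A → X → ℕ) → Φ (λ y → listSum L (λ a → f a y)) ≡ listSum L (λ a → Φ (f a))
  Φ-listSum [] f = Φ-zero
  Φ-listSum (a ∷ L) f = trans (Φ-+ (f a) _) (cong (Φ (f a) +_) (Φ-listSum L f))

  -- Cauchy–Schwarz: (Φ x)² ≤ Φ 1 · Φ (x²), obtained by applying Φ twice
  -- to 2 x(T) x(U) ≤ x(T)² + x(U)².
  cauchy-schwarz : ∀ x → Φ x * Φ x ≤ Φ (λ _ → 1) * Φ (λ T → x T * x T)
  cauchy-schwarz x = *-cancelˡ-≤ 2 (begin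
    2 * (S * S)                                   ≡⟨ double-sum-product ⟨
    Φ (λ T → Φ (λ U → 2 * (x T * x U)))           ≤⟨ Φ-mono (λ T → Φ-mono (λ U → 2ab≤a²+b² (x T) (x U))) ⟩
    Φ (λ T → Φ (λ U → x T * x T + x U * x U))     ≡⟨ double-sum-squares ⟩
    2 * (P * Q)                                   ∎)
    where
    open ≤-Reasoning
    S P Q : ℕ
    S = Φ x
    P = Φ (λ _ → 1)
    Q = Φ (λ T → x T * x T)

    double-sum-product : Φ (λ T → Φ (λ U → 2 * (x T * x U))) ≡ 2 * (S * S)
    double-sum-product = begin-equality
      Φ (λ T → Φ (λ U → 2 * (x T * x U)))  ≡⟨ Φ-cong (λ T → trans (Φ-scale 2 _) (cong (2 *_) (Φ-scale (x T) x))) ⟩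
      Φ (λ T → 2 * (x T * S))              ≡⟨ Φ-scale 2 _ ⟩
      2 * Φ (λ T → x T * S)                ≡⟨ cong (2 *_) (trans (Φ-cong (λ T → *-comm (x T) S)) (Φ-scale S x)) ⟩
      2 * (S * S)                          ∎

    double-sum-squares : Φ (λ T → Φ (λ U → x T * x T + x U * x U)) ≡ 2 * (P * Q)
    double-sum-squares = begin-equality
      Φ (λ T → Φ (λ U → x T * x T + x U * x U))  ≡⟨ Φ-cong (λ T → trans (Φ-+ _ _) (cong (_+ Q) (Φ-const (x T * x T)))) ⟩
      Φ (λ T → x T * x T * P + Q)                ≡⟨ Φ-+ _ _ ⟩
      Φ (λ T → x T * x T * P) + Φ (λ _ → Q)      ≡⟨ cong₂ _+_ (trans (Φ-cong (λ T → *-comm (x T * x T) P)) (Φ-scale P _))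
                                                              (trans (Φ-const Q) (*-comm Q P)) ⟩
      P * Q + P * Q                              ≡⟨ cong (P * Q +_) (sym (+-identityʳ (P * Q))) ⟩
      2 * (P * Q)                                ∎

listSum-positive : ∀ {A : Set} (L : List A) → PositiveLinear (listSum L)
listSum-positive {A} L = record
  { Φ-cong = pointwise L ; Φ-mono = mono L ; Φ-+ = additive L ; Φ-scale = scale L }
  where
  pointwise : ∀ L {f g : A → ℕ} → (∀ x → f x ≡ g x) → listSum L f ≡ listSum L g
  pointwise [] e = refl
  pointwise (x ∷ L) e = cong₂ _+_ (e x) (pointwise L e)
  mono : ∀ L {f g : A → ℕ} → (∀ x → f x ≤ g x) → listSum L f ≤ listSum L g
  mono [] le = z≤n
  mono (x ∷ L) le = +-mono-≤ (le x) (mono L le)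
  additive : ∀ L (f g : A → ℕ) → listSum L (λ x → f x + g x) ≡ listSum L f + listSum L g
  additive [] f g = refl
  additive (x ∷ L) f g = trans (cong (f x + g x +_) (additive L f g)) (+-+-comm (f x) (g x) _ _)
    where
    +-+-comm : ∀ a b c d → a + b + (c + d) ≡ a + c + (b + d)
    +-+-comm = solve-∀
  scale : ∀ L k (f : A → ℕ) → listSum L (λ x → k * f x) ≡ k * listSum L f
  scale [] k f = sym (*-zeroʳ k)
  scale (x ∷ L) k f = trans (cong (k * f x +_) (scale L k f)) (sym (*-distribˡ-+ k (f x) _))

listSum-++ : ∀ {A : Set} (xs ys : List A) f → listSum (xs ++ ys) f ≡ listSum xs f + listSum ys f
listSum-++ [] ys f = refl
listSum-++ (x ∷ xs) ys f = trans (cong (f x +_) (listSum-++ xs ys f)) (sym (+-assoc (f x) _ _))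

listSum-map : ∀ {A B : Set} (g : A → B) (xs : List A) f → listSum (map g xs) f ≡ listSum xs (f ∘ g)
listSum-map g [] f = refl
listSum-map g (x ∷ xs) f = cong (f (g x) +_) (listSum-map g xs f)

length-filter : ∀ {A : Set} {P : A → Set} (P? : ∀ x → Dec (P x)) (L : List A) →
  length (filter P? L) ≡ listSum L (λ x → ⟦ does (P? x) ⟧)
length-filter P? [] = refl
length-filter P? (x ∷ xs) with does (P? x)
... | true = cong suc (length-filter P? xs)
... | false = length-filter P? xs

filter-witness : ∀ {A : Set} {P : A → Set} (P? : ∀ x → Dec (P x)) (L : List A) →
  0 < length (filter P? L) → Σ A P
filter-witness P? (x ∷ L) pos with P? x
... | yes px = x , px
... | no _ = filter-witness P? L pos

_≟ˢ_ : ∀ {n} (p q : Subset n) → Dec (p ≡ q)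
_≟ˢ_ = Vec.≡-dec Bool._≟_

allSubsets-once : ∀ n (X : Subset n) → listSum (allSubsets n) (λ S → ⟦ does (S ≟ˢ X) ⟧) ≡ 1
allSubsets-once zero [] = refl
allSubsets-once (suc n) (b ∷ X) = begin
  listSum (map (true ∷_) L ++ map (false ∷_) L) occurs          ≡⟨ listSum-++ (map (true ∷_) L) _ occurs ⟩
  listSum (map (true ∷_) L) occurs + listSum (map (false ∷_) L) occurs
                                                                ≡⟨ cong₂ _+_ (listSum-map (true ∷_) L occurs) (listSum-map (false ∷_) L occurs) ⟩
  listSum L (occurs ∘ (true ∷_)) + listSum L (occurs ∘ (false ∷_)) ≡⟨ by-head b ⟩
  1                                                             ∎
  where
  open ≡-Reasoning
  open PositiveLinearProperties (listSum-positive (allSubsets n))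
  L : List (Subset n)
  L = allSubsets n
  occurs : Subset (suc n) → ℕ
  occurs S = ⟦ does (S ≟ˢ (b ∷ X)) ⟧
  by-head : ∀ b → listSum L (λ S → ⟦ does (true Bool.≟ b) ∧ does (S ≟ˢ X) ⟧)
                  + listSum L (λ S → ⟦ does (false Bool.≟ b) ∧ does (S ≟ˢ X) ⟧) ≡ 1
  by-head true = cong₂ _+_ (allSubsets-once n X) Φ-zero
  by-head false = cong₂ _+_ Φ-zero (allSubsets-once n X)

subset-ext : ∀ {n} {p q : Subset n} → (∀ v → v ∈ p → v ∈ q) → (∀ v → v ∈ q → v ∈ p) → p ≡ q
subset-ext p⊆q q⊆p = ⊆-antisym (λ {v} → p⊆q v) (λ {v} → q⊆p v)

card-count : ∀ {n} (p : Subset n) → ∣ p ∣ ≡ countFin n (λ v → does (v ∈? p))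
card-count [] = refl
card-count (inside ∷ p) = cong suc (card-count p)
card-count (outside ∷ p) = card-count p

card-tabulate : ∀ {n} (f : Fin n → Bool) → ∣ Vec.tabulate f ∣ ≡ ∑[ m < n ] ⟦ f m ⟧
card-tabulate {zero} f = refl
card-tabulate {suc n} f with f zero
... | true = cong suc (card-tabulate (f ∘ suc))
... | false = card-tabulate (f ∘ suc)

∈-tabulate : ∀ {n} (f : Fin n → Bool) m → f m ≡ true → m ∈ Vec.tabulate f
∈-tabulate f m fm = Vec.lookup⇒[]= m (Vec.tabulate f) (trans (Vec.lookup∘tabulate f m) fm)

extend-⊆ : ∀ {n} {P M : Subset n} b → (∀ x → x ∈ P → x ∈ M) → ∀ x → x ∈ (b ∷ P) → x ∈ (inside ∷ M)
extend-⊆ b P⊆M zero _ = here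
extend-⊆ b P⊆M (suc x) (there x∈) = there (P⊆M x x∈)

enlarge : ∀ {n} (P : Subset n) k → ∣ P ∣ ≤ k → k ≤ n →
  Σ (Subset n) λ M → (∀ x → x ∈ P → x ∈ M) × ∣ M ∣ ≡ k
enlarge [] zero _ _ = [] , (λ _ ()) , refl
enlarge (inside ∷ P) (suc k) (s≤s p≤k) (s≤s k≤n) with enlarge P k p≤k k≤n
... | M , P⊆M , refl = inside ∷ M , extend-⊆ inside P⊆M , refl
enlarge (outside ∷ P) k p≤k k≤1+n with ∣ P ∣ ≟ k
... | yes refl = outside ∷ P , (λ _ x∈ → x∈) , refl
... | no p≢k with k
...   | zero = ⊥-elim (p≢k (n≤0⇒n≡0 p≤k))
...   | suc k′ with enlarge P k′ (≤-pred (≤∧≢⇒< p≤k p≢k)) (≤-pred k≤1+n)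
...     | M , P⊆M , refl = inside ∷ M , extend-⊆ outside P⊆M , refl

-- The image of φ : Fin R → Fin N on the indices satisfying a decidable
-- predicate; Defs.imageMinus is the case "all indices but m".
image : ∀ {R N} (φ : Fin R → Fin N) {P : Fin R → Set} → (∀ y → Dec (P y)) → Subset N
image {R} φ P? = ⋃ (map (λ y → ⁅ φ y ⁆) (filter P? (allFin R)))

module _ {R N : ℕ} (φ : Fin R → Fin N) {P : Fin R → Set} (P? : ∀ y → Dec (P y)) where

  ⋃-singletons⁻ : ∀ (L : List (Fin R)) {v} → v ∈ ⋃ (map (λ y → ⁅ φ y ⁆) L) → Σ (Fin R) λ y → y List.∈ L × v ≡ φ y
  ⋃-singletons⁻ [] v∈ = ⊥-elim (∉⊥ v∈)
  ⋃-singletons⁻ (y ∷ L) v∈ with x∈p∪q⁻ ⁅ φ y ⁆ _ v∈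
  ... | inj₁ v∈φy = y , here refl , x∈⁅y⁆⇒x≡y (φ y) v∈φy
  ... | inj₂ v∈rest with ⋃-singletons⁻ L v∈rest
  ...   | y′ , y′∈L , v≡ = y′ , there y′∈L , v≡

  ⋃-singletons⁺ : ∀ (L : List (Fin R)) {y} → y List.∈ L → φ y ∈ ⋃ (map (λ y → ⁅ φ y ⁆) L)
  ⋃-singletons⁺ (y ∷ L) (here refl) = x∈p∪q⁺ (inj₁ (x∈⁅x⁆ (φ y)))
  ⋃-singletons⁺ (_ ∷ L) (there y∈L) = x∈p∪q⁺ (inj₂ (⋃-singletons⁺ L y∈L))

  image⁻ : ∀ {v} → v ∈ image φ P? → Σ (Fin R) λ y → P y × v ≡ φ y
  image⁻ v∈ with ⋃-singletons⁻ (filter P? (allFin R)) v∈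
  ... | y , y∈ , v≡ = y , proj₂ (∈-filter⁻ P? {xs = allFin R} y∈) , v≡

  image⁺ : ∀ y → P y → φ y ∈ image φ P?
  image⁺ y Py = ⋃-singletons⁺ (filter P? (allFin R)) (∈-filter⁺ P? (∈-allFin y) Py)

-- Sums over tuples of vertices with prescribed classes.  For a class pattern
-- c : Fin m → classes, tsum c F is the sum of F T over all T ∈ V_{c 0} × … × V_{c (m-1)}.
module TupleSums {r : ℕ} (G : PartiteGraph r) where
  open PartiteGraph G

  n : Fin (suc r) → ℕ
  n = classSize G

  χ : Fin (suc r) → Fin N → ℕ
  χ i x = ⟦ inClass G i x ⟧

  inClass-sound : ∀ {i x} → inClass G i x ≡ true → cls x ≡ i
  inClass-sound {i} {x} = does-true (cls x Fin.≟ i)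

  inClass-complete : ∀ {i x} → cls x ≡ i → inClass G i x ≡ true
  inClass-complete {i} {x} = dec-true (cls x Fin.≟ i)

  size-sum : ∀ i → n i ≡ ∑[ x < N ] χ i x
  size-sum i = count-sum N (inClass G i)

  Fits : ∀ {m} → (Fin m → Fin (suc r)) → Vec (Fin N) m → Set
  Fits c T = ∀ p → cls (lookup T p) ≡ c p

  tsum : ∀ {m} → (Fin m → Fin (suc r)) → (Vec (Fin N) m → ℕ) → ℕ
  tsum {zero} c F = F []
  tsum {suc m} c F = ∑[ x < N ] (χ (c zero) x * tsum (c ∘ suc) (λ T → F (x ∷ T)))

  slice : ∀ {m} (c : Fin (suc m) → Fin (suc r)) → (Vec (Fin N) (suc m) → ℕ) → Fin N → ℕ
  slice c F x = χ (c zero) x * tsum (c ∘ suc) (λ T → F (x ∷ T))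

  fits-∷ : ∀ {m} {c : Fin (suc m) → Fin (suc r)} {x T} → inClass G (c zero) x ≡ true →
    Fits (c ∘ suc) T → Fits c (x ∷ T)
  fits-∷ x∈ fits zero = inClass-sound x∈
  fits-∷ x∈ fits (suc p) = fits p

  tsum-mono-fits : ∀ {m} (c : Fin m → Fin (suc r)) {F H : Vec (Fin N) m → ℕ} →
    (∀ T → Fits c T → F T ≤ H T) → tsum c F ≤ tsum c H
  tsum-mono-fits {zero} c le = le [] (λ ())
  tsum-mono-fits {suc m} c {F} {H} le = sum-mono guarded
    where
    guarded : ∀ x → slice c F x ≤ slice c H x
    guarded x with inClass G (c zero) x in x∈
    ... | false = z≤n
    ... | true = *-monoʳ-≤ 1 (tsum-mono-fits (c ∘ suc) (λ T fits → le (x ∷ T) (fits-∷ x∈ fits)))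

  tsum-cong-fits : ∀ {m} (c : Fin m → Fin (suc r)) {F H : Vec (Fin N) m → ℕ} →
    (∀ T → Fits c T → F T ≡ H T) → tsum c F ≡ tsum c H
  tsum-cong-fits c eq = ≤-antisym (tsum-mono-fits c (λ T fits → ≤-reflexive (eq T fits)))
                                  (tsum-mono-fits c (λ T fits → ≤-reflexive (sym (eq T fits))))

  tsum-+ : ∀ {m} (c : Fin m → Fin (suc r)) F H → tsum c (λ T → F T + H T) ≡ tsum c F + tsum c H
  tsum-+ {zero} c F H = refl
  tsum-+ {suc m} c F H = trans (sum-cong-≗ split) (∑-distrib-+ (slice c F) (slice c H))
    where
    split : ∀ x → slice c (λ T → F T + H T) x ≡ slice c F x + slice c H x
    split x = trans (cong (χ (c zero) x *_) (tsum-+ (c ∘ suc) _ _)) (*-distribˡ-+ (χ (c zero) x) _ _)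

  tsum-scale : ∀ {m} (c : Fin m → Fin (suc r)) k F → tsum c (λ T → k * F T) ≡ k * tsum c F
  tsum-scale {zero} c k F = refl
  tsum-scale {suc m} c k F = trans (sum-cong-≗ commute) (sum-scale k (slice c F))
    where
    commute : ∀ x → slice c (λ T → k * F T) x ≡ k * slice c F x
    commute x = trans (cong (χ (c zero) x *_) (tsum-scale (c ∘ suc) k _)) (x∙yz≈y∙xz (χ (c zero) x) k _)

  tsum-positive : ∀ {m} (c : Fin m → Fin (suc r)) → PositiveLinear (tsum c)
  tsum-positive c = record
    { Φ-cong = λ eq → tsum-cong-fits c (λ T _ → eq T)
    ; Φ-mono = λ le → tsum-mono-fits c (λ T _ → le T)
    ; Φ-+ = tsum-+ c
    ; Φ-scale = tsum-scale c }

  tsum-head : ∀ {m} (c : Fin (suc m) → Fin (suc r)) (g : Fin N → ℕ) (F : Vec (Fin N) m → ℕ) →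
    tsum c (λ T → g (Vec.head T) * F (Vec.tail T)) ≡ ∑[ x < N ] (χ (c zero) x * g x) * tsum (c ∘ suc) F
  tsum-head c g F = begin
    ∑[ x < N ] (χ (c zero) x * tsum (c ∘ suc) (λ T → g x * F T))  ≡⟨ sum-cong-≗ pull ⟩
    ∑[ x < N ] (Q * (χ (c zero) x * g x))                         ≡⟨ sum-scale Q (λ x → χ (c zero) x * g x) ⟩
    Q * ∑[ x < N ] (χ (c zero) x * g x)                           ≡⟨ *-comm Q _ ⟩
    ∑[ x < N ] (χ (c zero) x * g x) * Q                           ∎
    where
    open ≡-Reasoning
    Q : ℕ
    Q = tsum (c ∘ suc) F
    pull : ∀ x → χ (c zero) x * tsum (c ∘ suc) (λ T → g x * F T) ≡ Q * (χ (c zero) x * g x)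
    pull x = begin
      χ (c zero) x * tsum (c ∘ suc) (λ T → g x * F T) ≡⟨ cong (χ (c zero) x *_) (tsum-scale (c ∘ suc) (g x) F) ⟩
      χ (c zero) x * (g x * Q)                        ≡⟨ sym (*-assoc (χ (c zero) x) (g x) Q) ⟩
      χ (c zero) x * g x * Q                          ≡⟨ *-comm _ Q ⟩
      Q * (χ (c zero) x * g x)                        ∎

  tsum-tail : ∀ {m} (c : Fin (suc m) → Fin (suc r)) (F : Vec (Fin N) m → ℕ) →
    tsum c (λ T → F (Vec.tail T)) ≡ n (c zero) * tsum (c ∘ suc) F
  tsum-tail c F = begin
    tsum c (λ T → F (Vec.tail T))                          ≡⟨ tsum-cong-fits c (λ T _ → sym (*-identityˡ (F (Vec.tail T)))) ⟩
    tsum c (λ T → 1 * F (Vec.tail T))                      ≡⟨ tsum-head c (λ _ → 1) F ⟩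
    ∑[ x < N ] (χ (c zero) x * 1) * tsum (c ∘ suc) F        ≡⟨ cong (_* tsum (c ∘ suc) F) size ⟩
    n (c zero) * tsum (c ∘ suc) F                          ∎
    where
    open ≡-Reasoning
    size : ∑[ x < N ] (χ (c zero) x * 1) ≡ n (c zero)
    size = trans (sum-cong-≗ (λ x → *-identityʳ (χ (c zero) x))) (sym (size-sum (c zero)))

  tsum-one : ∀ {m} (c : Fin m → Fin (suc r)) → tsum c (λ _ → 1) ≡ prod (n ∘ c)
  tsum-one {zero} c = refl
  tsum-one {suc m} c = trans (tsum-tail c (λ _ → 1)) (cong (n (c zero) *_) (tsum-one (c ∘ suc)))

  -- Resampling: re-choosing the i-th vertex of a tuple from its class and
  -- summing over all choices counts every tuple n(c i) times.
  resample : ∀ {m} (c : Fin m → Fin (suc r)) (i : Fin m) (F : Vec (Fin N) m → ℕ) →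
    tsum c (λ T → ∑[ a < N ] (χ (c i) a * F (T [ i ]≔ a))) ≡ n (c i) * tsum c F
  resample {suc m} c zero F = begin
    tsum c (λ T → Q (Vec.tail T))  ≡⟨ tsum-tail c Q ⟩
    n (c zero) * tsum (c ∘ suc) Q  ≡⟨ cong (n (c zero) *_) Q≡ ⟩
    n (c zero) * tsum c F          ∎
    where
    open ≡-Reasoning
    open PositiveLinearProperties (tsum-positive (c ∘ suc))
    Q : Vec (Fin N) m → ℕ
    Q T = ∑[ a < N ] (χ (c zero) a * F (a ∷ T))
    Q≡ : tsum (c ∘ suc) Q ≡ tsum c F
    Q≡ = trans (Φ-∑ N (λ a T → χ (c zero) a * F (a ∷ T)))
               (sum-cong-≗ (λ a → tsum-scale (c ∘ suc) (χ (c zero) a) (λ T → F (a ∷ T))))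
  resample {suc m} c (suc i) F = trans (sum-cong-≗ step) (sum-scale (n (c (suc i))) (slice c F))
    where
    step : ∀ x → slice c (λ T → ∑[ a < N ] (χ (c (suc i)) a * F (T [ suc i ]≔ a))) x ≡ n (c (suc i)) * slice c F x
    step x = trans (cong (χ (c zero) x *_) (resample (c ∘ suc) i (λ T → F (x ∷ T))))
                   (x∙yz≈y∙xz (χ (c zero) x) (n (c (suc i))) _)

  _≟ᵗ_ : ∀ {m} (T U : Vec (Fin N) m) → Dec (T ≡ U)
  _≟ᵗ_ = Vec.≡-dec Fin._≟_

  tsum-point : ∀ {m} (c : Fin m → Fin (suc r)) (U : Vec (Fin N) m) → Fits c U →
    tsum c (λ T → ⟦ does (T ≟ᵗ U) ⟧) ≡ 1
  tsum-point {zero} c [] _ = refl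
  tsum-point {suc m} c (u ∷ U) fits = begin
    ∑[ x < N ] (χ (c zero) x * tsum (c ∘ suc) (λ T → ⟦ does (x Fin.≟ u) ∧ does (T ≟ᵗ U) ⟧))
                                                ≡⟨ sum-cong-≗ (λ x → cong (χ (c zero) x *_) (tail-once x)) ⟩
    ∑[ x < N ] (χ (c zero) x * ⟦ does (x Fin.≟ u) ⟧)
                                                ≡⟨ sum-cong-≗ (λ x → *-comm (χ (c zero) x) _) ⟩
    ∑[ x < N ] (⟦ does (x Fin.≟ u) ⟧ * χ (c zero) x)
                                                ≡⟨ sum-pick u (χ (c zero)) ⟩
    χ (c zero) u                                ≡⟨ cong ⟦_⟧ (inClass-complete (fits zero)) ⟩
    1                                           ∎
    where
    open ≡-Reasoning
    tail-once : ∀ x → tsum (c ∘ suc) (λ T → ⟦ does (x Fin.≟ u) ∧ does (T ≟ᵗ U) ⟧) ≡ ⟦ does (x Fin.≟ u) ⟧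
    tail-once x = begin
      tsum (c ∘ suc) (λ T → ⟦ does (x Fin.≟ u) ∧ does (T ≟ᵗ U) ⟧)
        ≡⟨ tsum-cong-fits (c ∘ suc) (λ T _ → ⟦∧⟧ (does (x Fin.≟ u)) _) ⟩
      tsum (c ∘ suc) (λ T → ⟦ does (x Fin.≟ u) ⟧ * ⟦ does (T ≟ᵗ U) ⟧)
        ≡⟨ tsum-scale (c ∘ suc) ⟦ does (x Fin.≟ u) ⟧ (λ T → ⟦ does (T ≟ᵗ U) ⟧) ⟩
      ⟦ does (x Fin.≟ u) ⟧ * tsum (c ∘ suc) (λ T → ⟦ does (T ≟ᵗ U) ⟧)
        ≡⟨ cong (⟦ does (x Fin.≟ u) ⟧ *_) (tsum-point (c ∘ suc) U (fits ∘ suc)) ⟩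
      ⟦ does (x Fin.≟ u) ⟧ * 1
        ≡⟨ *-identityʳ _ ⟩
      ⟦ does (x Fin.≟ u) ⟧ ∎

  -- Lower bound by an injection: if every a ∈ V_{c i} yields a fitting tuple
  -- U a with property Q whose i-th vertex is a, then at least n (c i)
  -- fitting tuples have property Q.
  fiber-bound : ∀ {m} (c : Fin m → Fin (suc r)) (i : Fin m) (U : Fin N → Vec (Fin N) m)
    (Q : Vec (Fin N) m → Bool) → (∀ a → cls a ≡ c i → Fits c (U a) × Q (U a) ≡ true) →
    (∀ a → lookup (U a) i ≡ a) → n (c i) ≤ tsum c (λ T → ⟦ Q T ⟧)
  fiber-bound c i U Q good recover = begin
    n (c i)                                                       ≡⟨ size-sum (c i) ⟩
    ∑[ a < N ] χ (c i) a                                          ≡⟨ sum-cong-≗ spread ⟩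
    ∑[ a < N ] tsum c (λ T → χ (c i) a * ⟦ does (T ≟ᵗ U a) ⟧)     ≡⟨ Φ-∑ N (λ a T → χ (c i) a * ⟦ does (T ≟ᵗ U a) ⟧) ⟨
    tsum c (λ T → ∑[ a < N ] (χ (c i) a * ⟦ does (T ≟ᵗ U a) ⟧))   ≤⟨ tsum-mono-fits c (λ T _ → sum-mono (only-recovered T)) ⟩
    tsum c (λ T → ∑[ a < N ] (⟦ does (a Fin.≟ lookup T i) ⟧ * ⟦ Q T ⟧))
                                                                  ≡⟨ tsum-cong-fits c (λ T _ → sum-pick (lookup T i) (λ _ → ⟦ Q T ⟧)) ⟩
    tsum c (λ T → ⟦ Q T ⟧)                                        ∎
    where
    open ≤-Reasoning
    open PositiveLinearProperties (tsum-positive c)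
    spread : ∀ a → χ (c i) a ≡ tsum c (λ T → χ (c i) a * ⟦ does (T ≟ᵗ U a) ⟧)
    spread a with inClass G (c i) a in a∈
    ... | false = sym (tsum-scale c 0 (λ T → ⟦ does (T ≟ᵗ U a) ⟧))
    ... | true = sym (trans (tsum-scale c 1 _) (cong (1 *_) (tsum-point c (U a) (proj₁ (good a (inClass-sound a∈))))))
    only-recovered : ∀ T a → χ (c i) a * ⟦ does (T ≟ᵗ U a) ⟧ ≤ ⟦ does (a Fin.≟ lookup T i) ⟧ * ⟦ Q T ⟧
    only-recovered T a with inClass G (c i) a in a∈ | T ≟ᵗ U a
    ... | false | _ = z≤n
    ... | true | no _ = z≤n
    ... | true | yes refl = ≤-reflexive (sym (cong₂ _*_ (cong ⟦_⟧ (dec-true (a Fin.≟ lookup (U a) i) (sym (recover a))))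
                                                       (cong ⟦_⟧ (proj₂ (good a (inClass-sound a∈))))))

  search : ∀ {m} (c : Fin m → Fin (suc r)) (Q : Vec (Fin N) m → Set) → (∀ T → Dec (Q T)) →
    (Σ (Vec (Fin N) m) λ T → Fits c T × Q T) ⊎ (∀ T → Fits c T → ¬ Q T)
  search {zero} c Q Q? with Q? []
  ... | yes q = inj₁ ([] , (λ ()) , q)
  ... | no ¬q = inj₂ λ { [] _ → ¬q }
  search {suc m} c Q Q? with Fin.any? starts-with
    where
    starts-with : ∀ x → Dec (cls x ≡ c zero × Σ (Vec (Fin N) m) λ T → Fits (c ∘ suc) T × Q (x ∷ T))
    starts-with x with cls x Fin.≟ c zero | search (c ∘ suc) (λ T → Q (x ∷ T)) (λ T → Q? (x ∷ T))
    ... | no x∉ | _ = no (x∉ ∘ proj₁)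
    ... | yes x∈ | inj₁ found = yes (x∈ , found)
    ... | yes _ | inj₂ none = no (λ { (_ , T , fits , q) → none T fits q })
  ... | yes (x , x∈ , T , fits , q) = inj₁ (x ∷ T , (λ { zero → x∈ ; (suc p) → fits p }) , q)
  ... | no none = inj₂ (λ { (x ∷ T) fits q → none (x , fits zero , T , fits ∘ suc , q) })

-- Faces of a tuple T = (T_0,…,T_r): the m-th face is the set of its
-- vertices other than T_m, and e m T records whether it is an edge.  A
-- transversal has T_p ∈ V_p for every class p.
module Faces {r : ℕ} (G : PartiteGraph r) where
  open PartiteGraph G
  open TupleSums G

  Tuple : Set
  Tuple = Vec (Fin N) (suc r)

  Transversal : Tuple → Set
  Transversal = Fits (λ p → p)

  face : Tuple → Fin (suc r) → Subset N
  face T m = imageMinus G (lookup T) m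

  e : Fin (suc r) → Tuple → ℕ
  e m T = ⟦ edge (face T m) ⟧

  Σᵗ : (Tuple → ℕ) → ℕ
  Σᵗ = tsum (λ p → p)

  Π : ℕ
  Π = Σᵗ (λ _ → 1)

  A : Fin (suc r) → ℕ
  A m = Σᵗ (e m)

  face⁻ : ∀ T m {v} → v ∈ face T m → Σ (Fin (suc r)) λ y → y ≢ m × v ≡ lookup T y
  face⁻ T m = image⁻ (lookup T) (λ y → ¬? (y Fin.≟ m))

  face⁺ : ∀ T m y → y ≢ m → lookup T y ∈ face T m
  face⁺ T m = image⁺ (lookup T) (λ y → ¬? (y Fin.≟ m))

  face-cong : ∀ T U m → (∀ y → y ≢ m → lookup T y ≡ lookup U y) → face T m ≡ face U m
  face-cong T U m agree = subset-ext (included T U agree) (included U T (λ y y≢m → sym (agree y y≢m)))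
    where
    included : ∀ T U → (∀ y → y ≢ m → lookup T y ≡ lookup U y) → ∀ v → v ∈ face T m → v ∈ face U m
    included T U agree v v∈ with face⁻ T m v∈
    ... | y , y≢m , refl = subst (_∈ face U m) (sym (agree y y≢m)) (face⁺ U m y y≢m)

  face-update : ∀ T m a → face (T [ m ]≔ a) m ≡ face T m
  face-update T m a = face-cong (T [ m ]≔ a) T m (λ y y≢m → Vec.lookup∘update′ y≢m T a)

  meet : Subset N → Fin (suc r) → ℕ
  meet S l = countFin N (λ v → does (v ∈? S) ∧ inClass G l v)

  by-class : ∀ S → ∣ S ∣ ≡ ∑[ l < suc r ] meet S l
  by-class S = begin
    ∣ S ∣                                             ≡⟨ trans (card-count S) (count-sum N mem) ⟩
    ∑[ v < N ] ⟦ mem v ⟧                              ≡⟨ sum-cong-≗ spread ⟩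
    ∑[ v < N ] ∑[ l < suc r ] (⟦ mem v ⟧ * χ l v)     ≡⟨ ∑-comm (λ v l → ⟦ mem v ⟧ * χ l v) ⟩
    ∑[ l < suc r ] ∑[ v < N ] (⟦ mem v ⟧ * χ l v)     ≡⟨ sum-cong-≗ (λ l → sym (meet-sum l)) ⟩
    ∑[ l < suc r ] meet S l                           ∎
    where
    open ≡-Reasoning
    mem : Fin N → Bool
    mem v = does (v ∈? S)
    spread : ∀ v → ⟦ mem v ⟧ ≡ ∑[ l < suc r ] (⟦ mem v ⟧ * χ l v)
    spread v = sym (trans (sum-scale ⟦ mem v ⟧ (λ l → χ l v))
                          (trans (cong (⟦ mem v ⟧ *_) (sum-point (cls v))) (*-identityʳ _)))
    meet-sum : ∀ l → meet S l ≡ ∑[ v < N ] (⟦ mem v ⟧ * χ l v)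
    meet-sum l = trans (count-sum N _) (sum-cong-≗ (λ v → ⟦∧⟧ (mem v) (inClass G l v)))

  meet⁺ : ∀ S l {v} → v ∈ S → cls v ≡ l → 1 ≤ meet S l
  meet⁺ S l {v} v∈S v∈l = count-witness N _ v (cong₂ _∧_ (dec-true (v ∈? S) v∈S) (inClass-complete v∈l))

  meet-none : ∀ S l → (∀ v → v ∈ S → cls v ≢ l) → meet S l ≡ 0
  meet-none S l misses = count-none N _ absent
    where
    absent : ∀ v → does (v ∈? S) ∧ inClass G l v ≡ false
    absent v with v ∈? S | inClass G l v in v∈l
    ... | no _ | _ = refl
    ... | yes _ | false = refl
    ... | yes v∈S | true = ⊥-elim (misses v v∈S (inClass-sound v∈l))

  meet⁻ : ∀ S l → 1 ≤ meet S l → Σ (Fin N) λ v → v ∈ S × cls v ≡ l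
  meet⁻ S l pos with count-positive N _ pos
  ... | v , both = v , does-true (v ∈? S) (proj₁ (∧-split both)) , inClass-sound (proj₂ (∧-split both))

  meet-partite : ∀ S l → IsPartite G S → meet S l ≤ 1
  meet-partite S l partite = count-unique N _ same
    where
    same : ∀ x y → does (x ∈? S) ∧ inClass G l x ≡ true → does (y ∈? S) ∧ inClass G l y ≡ true → x ≡ y
    same x y px py with ∧-split px | ∧-split py
    ... | x∈ , x∈l | y∈ , y∈l = partite x y (does-true (x ∈? S) x∈) (does-true (y ∈? S) y∈)
                                          (trans (inClass-sound x∈l) (sym (inClass-sound y∈l)))

  inP : Fin (suc r) → Subset N → Bool
  inP i S = edge S ∧ avoids G i S

  -- The structure of an edge S of P_i: its vertices avoid V_i, and by the
  -- pigeonhole principle it has exactly one vertex in every other class.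
  module EdgeOfP (i : Fin (suc r)) (S : Subset N) (S∈P : inP i S ≡ true) where
    is-edge : T (edge S)
    is-edge = subst T (sym (proj₁ (∧-split S∈P))) _

    misses-i : meet S i ≡ 0
    misses-i = ≡ᵇ⇒≡ (meet S i) 0 (subst T (sym (proj₂ (∧-split S∈P))) _)

    outside-i : ∀ {v} → v ∈ S → cls v ≢ i
    outside-i v∈S v∈i = contradiction (subst (1 ≤_) misses-i (meet⁺ S i v∈S v∈i)) λ ()

    -- For l ≠ i, an empty S ∩ V_l would leave S at most r - 1 classes to meet.
    meets : ∀ l → l ≢ i → Σ (Fin N) λ v → v ∈ S × cls v ≡ l
    meets l l≢i with meet S l in meet-l
    ... | suc _ = meet⁻ S l (subst (1 ≤_) (sym meet-l) (s≤s z≤n))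
    ... | zero = contradiction too-many (<-irrefl refl)
      where
      out : Fin (suc r) → ℕ
      out l′ = ⟦ not (does (i Fin.≟ l′)) ∧ not (does (l Fin.≟ l′)) ⟧
      bounded : ∀ l′ → meet S l′ ≤ out l′
      bounded l′ with i Fin.≟ l′ | l Fin.≟ l′
      ... | yes refl | _ = ≤-reflexive misses-i
      ... | no _ | yes refl = ≤-reflexive meet-l
      ... | no _ | no _ = meet-partite S l′ (partite S is-edge)
      too-many : suc r < suc r
      too-many = begin
        2 + r                         ≡⟨ +-comm 2 r ⟩
        r + 2                         ≡⟨ cong (_+ 2) (sym (uniform S is-edge)) ⟩
        ∣ S ∣ + 2                     ≡⟨ cong (_+ 2) (by-class S) ⟩
        ∑[ l′ < suc r ] meet S l′ + 2 ≤⟨ +-monoˡ-≤ 2 (sum-mono bounded) ⟩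
        ∑[ l′ < suc r ] out l′ + 2    ≡⟨ except-two i l (l≢i ∘ sym) ⟩
        suc r                         ∎
        where open ≤-Reasoning

    vertex : Fin (suc r) → Fin N → Fin N
    vertex l a with l Fin.≟ i
    ... | yes _ = a
    ... | no l≢i = proj₁ (meets l l≢i)

    complete : Fin N → Tuple
    complete a = Vec.tabulate (λ l → vertex l a)

    complete-at-i : ∀ a → lookup (complete a) i ≡ a
    complete-at-i a with i Fin.≟ i | Vec.lookup∘tabulate (λ l → vertex l a) i
    ... | yes _ | at-i = at-i
    ... | no i≢i | _ = ⊥-elim (i≢i refl)

    complete-away : ∀ a l → l ≢ i → lookup (complete a) l ∈ S × cls (lookup (complete a) l) ≡ l
    complete-away a l l≢i with l Fin.≟ i | Vec.lookup∘tabulate (λ l → vertex l a) l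
    ... | yes l≡i | _ = ⊥-elim (l≢i l≡i)
    ... | no l≢i′ | at-l rewrite at-l = proj₂ (meets l l≢i′)

    complete-transversal : ∀ a → cls a ≡ i → Transversal (complete a)
    complete-transversal a a∈i l with l Fin.≟ i
    ... | yes refl = trans (cong cls (complete-at-i a)) a∈i
    ... | no l≢i = proj₂ (complete-away a l l≢i)

    complete-face : ∀ a → face (complete a) i ≡ S
    complete-face a = subset-ext to from
      where
      to : ∀ w → w ∈ face (complete a) i → w ∈ S
      to w w∈ with face⁻ (complete a) i w∈
      ... | y , y≢i , refl = proj₁ (complete-away a y y≢i)
      from : ∀ w → w ∈ S → w ∈ face (complete a) i
      from w w∈S = subst (_∈ face (complete a) i) (sym same-vertex) (face⁺ (complete a) i (cls w) (outside-i w∈S))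
        where
        away : lookup (complete a) (cls w) ∈ S × cls (lookup (complete a) (cls w)) ≡ cls w
        away = complete-away a (cls w) (outside-i w∈S)
        same-vertex : w ≡ lookup (complete a) (cls w)
        same-vertex = partite S is-edge w _ w∈S (proj₁ away) (sym (proj₂ away))

-- For a transversal T and classes i ≠ j, swapDeg i j T
-- counts the a ∈ V_i for which replacing T_i by a turns the j-th face into
-- an edge; this is the degree d(V_i, g) of the partite (r-1)-tuple
-- g = T ∖ {T_i, T_j}, so strict balance makes it symmetric in i and j.
module Degrees {r : ℕ} (G : PartiteGraph r) where
  open PartiteGraph G
  open TupleSums G
  open Faces G

  swapDeg : Fin (suc r) → Fin (suc r) → Tuple → ℕ
  swapDeg i j T = ∑[ a < N ] (χ i a * e j (T [ i ]≔ a))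

  Spans : Tuple → Fin (suc r) → Fin (suc r) → Subset N → Set
  Spans T i j g = (∀ {w} → w ∈ g → Σ (Fin (suc r)) λ y → y ≢ i × y ≢ j × w ≡ lookup T y)
                × (∀ y → y ≢ i → y ≢ j → lookup T y ∈ g)

  spans-sym : ∀ T {i j g} → Spans T i j g → Spans T j i g
  spans-sym T (g⁻ , g⁺) = (λ w∈ → let y , y≢i , y≢j , w≡ = g⁻ w∈ in y , y≢j , y≢i , w≡)
                      , (λ y y≢j y≢i → g⁺ y y≢i y≢j)

  add-vertex : ∀ T {i j g} → i ≢ j → Spans T i j g → ∀ v → g ∪ ⁅ v ⁆ ≡ face (T [ i ]≔ v) j
  add-vertex T {i} {j} {g} i≢j (g⁻ , g⁺) v = subset-ext to from
    where
    to : ∀ w → w ∈ g ∪ ⁅ v ⁆ → w ∈ face (T [ i ]≔ v) j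
    to w w∈ with x∈p∪q⁻ g ⁅ v ⁆ w∈
    ... | inj₁ w∈g with g⁻ w∈g
    ...   | y , y≢i , y≢j , refl =
            subst (_∈ face (T [ i ]≔ v) j) (Vec.lookup∘update′ y≢i T v) (face⁺ (T [ i ]≔ v) j y y≢j)
    to w w∈ | inj₂ w∈v =
            subst (_∈ face (T [ i ]≔ v) j) (trans (Vec.lookup∘update i T v) (sym (x∈⁅y⁆⇒x≡y v w∈v)))
                  (face⁺ (T [ i ]≔ v) j i i≢j)
    from : ∀ w → w ∈ face (T [ i ]≔ v) j → w ∈ g ∪ ⁅ v ⁆
    from w w∈ with face⁻ (T [ i ]≔ v) j w∈
    ... | y , y≢j , refl with y Fin.≟ i
    ...   | yes refl = x∈p∪q⁺ (inj₂ (subst (_∈ ⁅ v ⁆) (sym (Vec.lookup∘update y T v)) (x∈⁅x⁆ v)))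
    ...   | no y≢i = x∈p∪q⁺ (inj₁ (subst (_∈ g) (sym (Vec.lookup∘update′ y≢i T v)) (g⁺ y y≢i y≢j)))

  deg-swapDeg : ∀ T {i j g} → i ≢ j → Spans T i j g → deg G i g ≡ swapDeg i j T
  deg-swapDeg T {i} {j} {g} i≢j spans = trans (count-sum N _) (sum-cong-≗ same)
    where
    same : ∀ v → ⟦ inClass G i v ∧ edge (g ∪ ⁅ v ⁆) ⟧ ≡ χ i v * e j (T [ i ]≔ v)
    same v = trans (⟦∧⟧ (inClass G i v) _) (cong (λ S → χ i v * ⟦ edge S ⟧) (add-vertex T i≢j spans v))

  others : Tuple → Fin (suc r) → Fin (suc r) → Subset N
  others T i j = image (lookup T) (λ y → ¬? (y Fin.≟ i) ×-dec ¬? (y Fin.≟ j))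

  others-spans : ∀ T i j → Spans T i j (others T i j)
  others-spans T i j =
      (λ w∈ → let y , (y≢i , y≢j) , w≡ = image⁻ (lookup T) (λ y → ¬? (y Fin.≟ i) ×-dec ¬? (y Fin.≟ j)) w∈
              in y , y≢i , y≢j , w≡)
    , (λ y y≢i y≢j → image⁺ (lookup T) (λ y → ¬? (y Fin.≟ i) ×-dec ¬? (y Fin.≟ j)) y (y≢i , y≢j))

  module Others {T : Tuple} (tr : Transversal T) {i j : Fin (suc r)} (i≢j : i ≢ j) where
    g : Subset N
    g = others T i j

    class-of : ∀ {w} → w ∈ g → Σ (Fin (suc r)) λ y → y ≢ i × y ≢ j × cls w ≡ y
    class-of w∈ with proj₁ (others-spans T i j) w∈
    ... | y , y≢i , y≢j , refl = y , y≢i , y≢j , tr y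

    partite′ : IsPartite G g
    partite′ x y x∈ y∈ same with proj₁ (others-spans T i j) x∈ | proj₁ (others-spans T i j) y∈
    ... | a , _ , _ , refl | b , _ , _ , refl = cong (lookup T) (trans (sym (tr a)) (trans same (tr b)))

    misses : ∀ m → (m ≡ i ⊎ m ≡ j) → ClassMisses G m g
    misses m m∈ij v v∈ v∈m with class-of v∈ | m∈ij
    ... | y , y≢i , y≢j , v∈y | inj₁ refl = y≢i (trans (sym v∈y) v∈m)
    ... | y , y≢i , y≢j , v∈y | inj₂ refl = y≢j (trans (sym v∈y) v∈m)

    meet-g : ∀ l → meet g l ≡ ⟦ not (does (i Fin.≟ l)) ∧ not (does (j Fin.≟ l)) ⟧
    meet-g l with i Fin.≟ l | j Fin.≟ l
    ... | yes refl | _ = meet-none g l (misses l (inj₁ refl))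
    ... | no _ | yes refl = meet-none g l (misses l (inj₂ refl))
    ... | no i≢l | no j≢l = ≤-antisym (meet-partite g l partite′)
                                      (meet⁺ g l (proj₂ (others-spans T i j) l (i≢l ∘ sym) (j≢l ∘ sym)) (tr l))

    -- g meets exactly the r - 1 classes other than V_i and V_j, once each.
    size : ∣ g ∣ ≡ r ∸ 1
    size = +-cancelʳ-≡ 2 ∣ g ∣ (r ∸ 1) (begin
      ∣ g ∣ + 2                                                     ≡⟨ cong (_+ 2) (by-class g) ⟩
      ∑[ l < suc r ] meet g l + 2                                   ≡⟨ cong (_+ 2) (sum-cong-≗ meet-g) ⟩
      ∑[ l < suc r ] ⟦ not (does (i Fin.≟ l)) ∧ not (does (j Fin.≟ l)) ⟧ + 2
                                                                    ≡⟨ except-two i j i≢j ⟩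
      suc r                                                         ≡⟨ two-classes r i j i≢j ⟩
      r ∸ 1 + 2                                                     ∎)
      where
      open ≡-Reasoning
      two-classes : ∀ r (i j : Fin (suc r)) → i ≢ j → suc r ≡ r ∸ 1 + 2
      two-classes zero zero zero i≢j = ⊥-elim (i≢j refl)
      two-classes (suc r) _ _ _ = +-comm 2 r

    balanced : AllBalanced G → swapDeg i j T ≡ swapDeg j i T
    balanced all = begin
      swapDeg i j T  ≡⟨ deg-swapDeg T i≢j (others-spans T i j) ⟨
      deg G i g      ≡⟨ all g (size , partite′) i j i≢j (misses i (inj₁ refl)) (misses j (inj₂ refl)) ⟩
      deg G j g      ≡⟨ deg-swapDeg T (i≢j ∘ sym) (spans-sym T (others-spans T i j)) ⟩
      swapDeg j i T  ∎
      where open ≡-Reasoning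

  both : Fin (suc r) → Fin (suc r) → Tuple → ℕ
  both i j T = e i T * e j T

  sum-swapDeg : ∀ i j → Σᵗ (swapDeg i j) ≡ n i * A j
  sum-swapDeg i j = resample (λ p → p) i (e j)

  -- The key inequality A_i A_j ≤ Π · #{T : both the i-th and j-th faces are
  -- edges}: Cauchy–Schwarz applied to swapDeg i j, whose sum is n_i A_j,
  -- while by balance its square sums to n_i n_j times the right-hand count.
  module Pair {i j : Fin (suc r)} (i≢j : i ≢ j) where
    -- swapDeg i j T · swapDeg j i T counts the pairs (a, b) ∈ V_i × V_j for
    -- which T with T_i := a and T_j := b has both faces as edges.
    both-after : Tuple → ℕ
    both-after U = ∑[ b < N ] (χ j b * both i j (U [ j ]≔ b))

    swapDeg-product : ∀ T → swapDeg i j T * swapDeg j i T ≡ ∑[ a < N ] (χ i a * both-after (T [ i ]≔ a))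
    swapDeg-product T = begin
      swapDeg i j T * swapDeg j i T                          ≡⟨ *-distribʳ-sum (swapDeg j i T) (λ a → χ i a * e j (T [ i ]≔ a)) ⟩
      ∑[ a < N ] (χ i a * e j (T [ i ]≔ a) * swapDeg j i T)  ≡⟨ sum-cong-≗ (λ a → *-assoc (χ i a) _ _) ⟩
      ∑[ a < N ] (χ i a * (e j (T [ i ]≔ a) * swapDeg j i T)) ≡⟨ sum-cong-≗ (λ a → cong (χ i a *_) (inner a)) ⟩
      ∑[ a < N ] (χ i a * both-after (T [ i ]≔ a))           ∎
      where
      open ≡-Reasoning
      faces-commute : ∀ a b → e i (T [ j ]≔ b) ≡ e i ((T [ i ]≔ a) [ j ]≔ b)
      faces-commute a b = begin
        e i (T [ j ]≔ b)                 ≡⟨ cong (λ S → ⟦ edge S ⟧) (face-update (T [ j ]≔ b) i a) ⟨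
        e i ((T [ j ]≔ b) [ i ]≔ a)      ≡⟨ cong (e i) (Vec.[]≔-commutes T i j i≢j) ⟨
        e i ((T [ i ]≔ a) [ j ]≔ b)      ∎
      inner : ∀ a → e j (T [ i ]≔ a) * swapDeg j i T ≡ both-after (T [ i ]≔ a)
      inner a = trans (sym (sum-scale (e j (T [ i ]≔ a)) (λ b → χ j b * e i (T [ j ]≔ b))))
                      (sum-cong-≗ reorder)
        where
        reorder : ∀ b → e j (T [ i ]≔ a) * (χ j b * e i (T [ j ]≔ b)) ≡ χ j b * both i j ((T [ i ]≔ a) [ j ]≔ b)
        reorder b = begin
          e j (T [ i ]≔ a) * (χ j b * e i (T [ j ]≔ b))   ≡⟨ x∙yz≈y∙xz (e j (T [ i ]≔ a)) (χ j b) _ ⟩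
          χ j b * (e j (T [ i ]≔ a) * e i (T [ j ]≔ b))   ≡⟨ cong (χ j b *_) (*-comm (e j (T [ i ]≔ a)) _) ⟩
          χ j b * (e i (T [ j ]≔ b) * e j (T [ i ]≔ a))   ≡⟨ cong (χ j b *_) (cong₂ _*_ (faces-commute a b)
                                                               (sym (cong (λ S → ⟦ edge S ⟧) (face-update (T [ i ]≔ a) j b)))) ⟩
          χ j b * both i j ((T [ i ]≔ a) [ j ]≔ b)        ∎

    sum-swapDeg-product : Σᵗ (λ T → swapDeg i j T * swapDeg j i T) ≡ n i * (n j * Σᵗ (both i j))
    sum-swapDeg-product = begin
      Σᵗ (λ T → swapDeg i j T * swapDeg j i T)                ≡⟨ tsum-cong-fits (λ p → p) (λ T _ → swapDeg-product T) ⟩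
      Σᵗ (λ T → ∑[ a < N ] (χ i a * both-after (T [ i ]≔ a))) ≡⟨ resample (λ p → p) i both-after ⟩
      n i * Σᵗ both-after                                     ≡⟨ cong (n i *_) (resample (λ p → p) j (both i j)) ⟩
      n i * (n j * Σᵗ (both i j))                             ∎
      where open ≡-Reasoning

    pair-inequality : AllBalanced G → 0 < n i → 0 < n j → A i * A j ≤ Π * Σᵗ (both i j)
    pair-inequality all ni>0 nj>0 = *-cancelˡ-≤ (n i * n j) {{>-nonZero (*-mono-≤ ni>0 nj>0)}} (begin
      n i * n j * (A i * A j)                  ≡⟨ rearrange (n i) (n j) (A j) (A i) ⟩
      (n i * A j) * (n j * A i)                ≡⟨ cong₂ _*_ (sym (sum-swapDeg i j)) (sym (sum-swapDeg j i)) ⟩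
      Σᵗ x * Σᵗ (swapDeg j i)                  ≡⟨ cong (Σᵗ x *_) (tsum-cong-fits (λ p → p) symmetric) ⟨
      Σᵗ x * Σᵗ x                              ≤⟨ cauchy-schwarz x ⟩
      Π * Σᵗ (λ T → x T * x T)                 ≡⟨ cong (Π *_) (tsum-cong-fits (λ p → p) (λ T tr → cong (x T *_) (symmetric T tr))) ⟩
      Π * Σᵗ (λ T → x T * swapDeg j i T)       ≡⟨ cong (Π *_) sum-swapDeg-product ⟩
      Π * (n i * (n j * Σᵗ (both i j)))        ≡⟨ rearrange′ (n i) (n j) Π (Σᵗ (both i j)) ⟩
      n i * n j * (Π * Σᵗ (both i j))          ∎)
      where
      open ≤-Reasoning
      open PositiveLinearProperties (tsum-positive (λ p → p))
      x : Tuple → ℕ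
      x = swapDeg i j
      symmetric : ∀ T → Transversal T → x T ≡ swapDeg j i T
      symmetric T tr = Others.balanced {T} tr i≢j all
      rearrange : ∀ a b c d → a * b * (d * c) ≡ (a * c) * (b * d)
      rearrange = solve-∀
      rearrange′ : ∀ a b p h → p * (a * (b * h)) ≡ a * b * (p * h)
      rearrange′ = solve-∀

module Density {r : ℕ} (G : PartiteGraph r) where
  open PartiteGraph G
  open TupleSums G
  open Faces G

  transversals-count : ∀ i → Π ≡ prodOthers G i * n i
  transversals-count i = begin
    Π                                                      ≡⟨ tsum-one (λ p → p) ⟩
    prod n                                                 ≡⟨ prod-except n i ⟨
    prod (λ p → if does (p Fin.≟ i) then 1 else n p) * n i ≡⟨ cong (_* n i) (product-filter (λ p → p) n i) ⟨
    prodOthers G i * n i                                   ∎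
    where open ≡-Reasoning

  -- Every edge S of P_i and every a ∈ V_i give a distinct transversal whose
  -- i-th face is S.
  edges-bound : ∀ i → edgesP G i * n i ≤ A i
  edges-bound i = begin
    edgesP G i * n i                                   ≡⟨ cong (_* n i) (length-filter (λ S → T? (inP i S)) L) ⟩
    listSum L (λ S → ⟦ inP i S ⟧) * n i                ≡⟨ *-comm _ (n i) ⟩
    n i * listSum L (λ S → ⟦ inP i S ⟧)                ≡⟨ Over-L.Φ-scale (n i) (λ S → ⟦ inP i S ⟧) ⟨
    listSum L (λ S → n i * ⟦ inP i S ⟧)                ≤⟨ Over-L.Φ-mono per-edge ⟩
    listSum L (λ S → Σᵗ (λ T → ⟦ inP i S ⟧ * is-face S T))
                                                       ≡⟨ Φ-listSum L (λ S T → ⟦ inP i S ⟧ * is-face S T) ⟨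
    Σᵗ (λ T → listSum L (λ S → ⟦ inP i S ⟧ * is-face S T))
                                                       ≤⟨ tsum-mono-fits (λ p → p) (λ T _ → per-transversal T) ⟩
    A i                                                ∎
    where
    open ≤-Reasoning
    open PositiveLinearProperties (tsum-positive (λ p → p))
    module Over-L = PositiveLinear (listSum-positive (allSubsets N))
    L : List (Subset N)
    L = allSubsets N
    is-face : Subset N → Tuple → ℕ
    is-face S T = ⟦ does (S ≟ˢ face T i) ⟧

    per-edge : ∀ S → n i * ⟦ inP i S ⟧ ≤ Σᵗ (λ T → ⟦ inP i S ⟧ * is-face S T)
    per-edge S with inP i S in S∈P
    ... | false = ≤-trans (≤-reflexive (*-zeroʳ (n i))) z≤n
    ... | true = begin
      n i * 1                        ≡⟨ *-identityʳ (n i) ⟩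
      n i                            ≤⟨ fiber-bound (λ p → p) i complete (λ T → does (S ≟ˢ face T i))
                                          (λ a a∈i → complete-transversal a a∈i , dec-true (S ≟ˢ _) (sym (complete-face a)))
                                          complete-at-i ⟩
      Σᵗ (is-face S)                 ≡⟨ tsum-cong-fits (λ p → p) (λ T _ → sym (*-identityˡ (is-face S T))) ⟩
      Σᵗ (λ T → 1 * is-face S T)     ∎
      where open EdgeOfP i S S∈P

    per-transversal : ∀ T → listSum L (λ S → ⟦ inP i S ⟧ * is-face S T) ≤ e i T
    per-transversal T = begin
      listSum L (λ S → ⟦ inP i S ⟧ * is-face S T)  ≡⟨ Over-L.Φ-cong only-face ⟩
      listSum L (λ S → ⟦ inP i F ⟧ * is-face S T)  ≡⟨ Over-L.Φ-scale ⟦ inP i F ⟧ (λ S → is-face S T) ⟩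
      ⟦ inP i F ⟧ * listSum L (λ S → is-face S T)  ≡⟨ cong (⟦ inP i F ⟧ *_) (allSubsets-once N F) ⟩
      ⟦ inP i F ⟧ * 1                              ≡⟨ *-identityʳ _ ⟩
      ⟦ edge F ∧ avoids G i F ⟧                    ≤⟨ ⟦∧⟧≤ (edge F) (avoids G i F) ⟩
      e i T                                        ∎
      where
      F : Subset N
      F = face T i
      only-face : ∀ S → ⟦ inP i S ⟧ * is-face S T ≡ ⟦ inP i F ⟧ * is-face S T
      only-face S with S ≟ˢ F
      ... | yes refl = refl
      ... | no _ = trans (*-zeroʳ ⟦ inP i S ⟧) (sym (*-zeroʳ ⟦ inP i F ⟧))
      ⟦∧⟧≤ : ∀ a b → ⟦ a ∧ b ⟧ ≤ ⟦ a ⟧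
      ⟦∧⟧≤ true b = ⟦⟧≤1 b
      ⟦∧⟧≤ false b = z≤n

  -- An edge of P_j meets V_i for every i ≠ j.
  class-nonempty : ∀ {i j} → i ≢ j → 0 < edgesP G j → 0 < n i
  class-nonempty {i} {j} i≢j pos with filter-witness (λ S → T? (inP j S)) (allSubsets N) pos
  ... | S , S∈P with EdgeOfP.meets j S (Equivalence.to Bool.T-≡ S∈P) i i≢j
  ...   | v , _ , v∈i = count-witness N (inClass G i) v (inClass-complete v∈i)

  classes-nonempty : ∀ c → 1 ≤ r → (∀ j → c * prodOthers G j < r * edgesP G j) → ∀ i → 0 < n i
  classes-nonempty c 1≤r dense i with another (s≤s 1≤r) i
  ... | j , i≢j = class-nonempty i≢j (positive-factor {b = r} (dense j))

  dense-transversals : ∀ c → 1 ≤ r → (∀ i → c * prodOthers G i < r * edgesP G i) → ∀ i → c * Π < r * A i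
  dense-transversals c 1≤r dense i = begin-strict
    c * Π                       ≡⟨ cong (c *_) (transversals-count i) ⟩
    c * (prodOthers G i * n i)  ≡⟨ *-assoc c _ (n i) ⟨
    c * prodOthers G i * n i    <⟨ *-monoˡ-< (n i) {{>-nonZero (classes-nonempty c 1≤r dense i)}} (dense i) ⟩
    r * edgesP G i * n i        ≡⟨ *-assoc r _ (n i) ⟩
    r * (edgesP G i * n i)      ≤⟨ *-monoʳ-≤ r (edges-bound i) ⟩
    r * A i                     ∎
    where open ≤-Reasoning

-- If every transversal has at most c + 1 edge faces, the pair inequalities
-- give Σ_j A_j ≤ A_i + cΠ for every i; summing over i contradicts c Π < r A_i.
module Counting {r : ℕ} (G : PartiteGraph r) where
  open PartiteGraph G
  open TupleSums G
  open Faces G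
  open Degrees G

  edge-faces : Tuple → ℕ
  edge-faces T = ∑[ m < suc r ] e m T

  away : Fin (suc r) → Fin (suc r) → ℕ
  away i j = ⟦ not (does (j Fin.≟ i)) ⟧

  -- With at most c + 1 edge faces, an edge face has at most c edge faces beside it.
  local-bound : ∀ c i T → edge-faces T ≤ suc c → ∑[ j < suc r ] (away i j * both i j T) ≤ c * e i T
  local-bound c i T few = begin
    ∑[ j < suc r ] (away i j * (e i T * e j T))  ≡⟨ sum-cong-≗ (λ j → x∙yz≈y∙xz (away i j) (e i T) (e j T)) ⟩
    ∑[ j < suc r ] (e i T * (away i j * e j T))  ≡⟨ sum-scale (e i T) (λ j → away i j * e j T) ⟩
    e i T * rest                                 ≤⟨ scaled (edge (face T i)) (subst (_≤ suc c) (sum-split i (λ m → e m T)) few) ⟩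
    c * e i T                                    ∎
    where
    open ≤-Reasoning
    rest : ℕ
    rest = ∑[ j < suc r ] (away i j * e j T)
    scaled : ∀ b → ⟦ b ⟧ + rest ≤ suc c → ⟦ b ⟧ * rest ≤ c * ⟦ b ⟧
    scaled false _ = z≤n
    scaled true (s≤s rest≤c) = subst₂ _≤_ (sym (+-identityʳ rest)) (sym (*-identityʳ c)) rest≤c

  module _ (c : ℕ) (balanced : AllBalanced G) (nonempty : ∀ i → 0 < n i)
           (dense : ∀ i → c * Π < r * A i) (poor : ∀ T → Transversal T → edge-faces T ≤ suc c) where
    open PositiveLinearProperties (tsum-positive (λ p → p))

    co-edges : ∀ i → ∑[ j < suc r ] (away i j * Σᵗ (both i j)) ≤ c * A i
    co-edges i = begin
      ∑[ j < suc r ] (away i j * Σᵗ (both i j))     ≡⟨ sum-cong-≗ (λ j → tsum-scale (λ p → p) (away i j) (both i j)) ⟨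
      ∑[ j < suc r ] Σᵗ (λ T → away i j * both i j T) ≡⟨ Φ-∑ (suc r) (λ j T → away i j * both i j T) ⟨
      Σᵗ (λ T → ∑[ j < suc r ] (away i j * both i j T)) ≤⟨ tsum-mono-fits (λ p → p) (λ T tr → local-bound c i T (poor T tr)) ⟩
      Σᵗ (λ T → c * e i T)                          ≡⟨ tsum-scale (λ p → p) c (e i) ⟩
      c * A i                                       ∎
      where open ≤-Reasoning

    -- Σ_{j ≠ i} A_j ≤ c Π, after cancelling A_i from Σ_{j ≠ i} A_i A_j ≤ Π · c A_i.
    others-bound : ∀ i → ∑[ j < suc r ] (away i j * A j) ≤ c * Π
    others-bound i = *-cancelˡ-≤ (A i) {{>-nonZero (positive-factor {b = r} (dense i))}} (begin
      A i * ∑[ j < suc r ] (away i j * A j)           ≡⟨ sum-scale (A i) (λ j → away i j * A j) ⟨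
      ∑[ j < suc r ] (A i * (away i j * A j))         ≤⟨ sum-mono pair ⟩
      ∑[ j < suc r ] (Π * (away i j * Σᵗ (both i j))) ≡⟨ sum-scale Π (λ j → away i j * Σᵗ (both i j)) ⟩
      Π * ∑[ j < suc r ] (away i j * Σᵗ (both i j))   ≤⟨ *-monoʳ-≤ Π (co-edges i) ⟩
      Π * (c * A i)                                   ≡⟨ x∙yz≈y∙xz Π c (A i) ⟩
      c * (Π * A i)                                   ≡⟨ cong (c *_) (*-comm Π (A i)) ⟩
      c * (A i * Π)                                   ≡⟨ x∙yz≈y∙xz c (A i) Π ⟩
      A i * (c * Π)                                   ∎)
      where
      open ≤-Reasoning
      pair : ∀ j → A i * (away i j * A j) ≤ Π * (away i j * Σᵗ (both i j))
      pair j with j Fin.≟ i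
      ... | yes _ = ≤-reflexive (trans (*-zeroʳ (A i)) (sym (*-zeroʳ Π)))
      ... | no j≢i = subst₂ _≤_ (cong (A i *_) (sym (+-identityʳ (A j)))) (cong (Π *_) (sym (+-identityʳ _)))
                            (Pair.pair-inequality (j≢i ∘ sym) balanced (nonempty i) (nonempty j))

    total-bound : ∀ i → sum A ≤ A i + c * Π
    total-bound i = ≤-trans (≤-reflexive (sum-split i A)) (+-monoʳ-≤ (A i) (others-bound i))

    -- Summing total-bound over i gives (r+1) Σ A ≤ Σ A + (r+1) cΠ < Σ A + r Σ A.
    impossible : ⊥
    impossible = <-irrefl refl (begin-strict
      suc r * sum A                       ≡⟨ sum-const (suc r) (sum A) ⟨
      ∑[ i < suc r ] sum A                ≤⟨ sum-mono total-bound ⟩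
      ∑[ i < suc r ] (A i + c * Π)        ≡⟨ ∑-distrib-+ A (λ _ → c * Π) ⟩
      sum A + ∑[ i < suc r ] (c * Π)      <⟨ +-monoʳ-< (sum A) (sum-strict dense) ⟩
      sum A + ∑[ i < suc r ] (r * A i)    ≡⟨ cong (sum A +_) (sum-scale r A) ⟩
      sum A + r * sum A                   ∎)
      where open ≤-Reasoning

-- A transversal with at least r + 1 - k edge faces spans a copy of K_{r+1}^r - k:
-- its non-edge faces, padded to exactly k faces, are the deleted ones.
module Copy {r : ℕ} (G : PartiteGraph r) where
  open PartiteGraph G
  open Faces G
  open Counting G using (edge-faces)

  module FromRich (k : ℕ) (k≤r : k ≤ r) (U : Tuple) (tr : Transversal U) (rich : suc (r ∸ k) ≤ edge-faces U) where
    non-edge : Fin (suc r) → Bool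
    non-edge m = not (edge (face U m))

    missing : Subset (suc r)
    missing = Vec.tabulate non-edge

    every-face : ∣ missing ∣ + edge-faces U ≡ suc r
    every-face = begin
      ∣ missing ∣ + edge-faces U                   ≡⟨ cong (_+ edge-faces U) (card-tabulate non-edge) ⟩
      ∑[ m < suc r ] ⟦ non-edge m ⟧ + edge-faces U  ≡⟨ ∑-distrib-+ (λ m → ⟦ non-edge m ⟧) (λ m → e m U) ⟨
      ∑[ m < suc r ] (⟦ non-edge m ⟧ + e m U)       ≡⟨ sum-cong-≗ (λ m → ⟦not⟧ (edge (face U m))) ⟩
      ∑[ m < suc r ] 1                             ≡⟨ trans (sum-const (suc r) 1) (*-identityʳ (suc r)) ⟩
      suc r                                        ∎
      where open ≡-Reasoning

    few-missing : ∣ missing ∣ ≤ k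
    few-missing = +-cancelʳ-≤ (suc (r ∸ k)) ∣ missing ∣ k (begin
      ∣ missing ∣ + suc (r ∸ k)  ≤⟨ +-monoʳ-≤ ∣ missing ∣ rich ⟩
      ∣ missing ∣ + edge-faces U ≡⟨ every-face ⟩
      suc r                      ≡⟨ cong suc (m+[n∸m]≡n k≤r) ⟨
      suc (k + (r ∸ k))          ≡⟨ +-suc k (r ∸ k) ⟨
      k + suc (r ∸ k)            ∎)
      where open ≤-Reasoning

    injective : ∀ x y → lookup U x ≡ lookup U y → x ≡ y
    injective x y same = trans (sym (tr x)) (trans (cong cls same) (tr y))

    copy : ContainsKminus G k
    copy with enlarge missing k few-missing (m≤n⇒m≤1+n k≤r)
    ... | M , missing⊆M , |M|≡k = lookup U , injective , M , |M|≡k , edges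
      where
      edges : ∀ m → m ∉ M → T (edge (imageMinus G (lookup U) m))
      edges m m∉M with edge (face U m) in face-m
      ... | true = _
      ... | false = ⊥-elim (m∉M (missing⊆M m (∈-tabulate non-edge m (cong not face-m))))
corollary3p8 : (r k : ℕ) → 2 ≤ r → k ≤ r ∸ 1 → (G : PartiteGraph r) →
    AllBalanced G →
    (∀ (i : Fin (suc r)) → (r ∸ (k + 1)) * prodOthers G i < r * edgesP G i) →
    ContainsKminus G k
corollary3p8 (suc zero) k (s≤s ()) _ _ _ _
corollary3p8 r@(suc (suc _)) k _ k≤r-1 G balanced dense
  with TupleSums.search G (λ p → p) (λ T → suc (r ∸ k) ≤ Counting.edge-faces G T)
                                    (λ T → suc (r ∸ k) ≤? Counting.edge-faces G T)
... | inj₁ (T , tr , rich) = Copy.FromRich.copy G k (≤-trans k≤r-1 (m∸n≤m r 1)) T tr rich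
... | inj₂ none = ⊥-elim (Counting.impossible G (r ∸ (k + 1)) balanced
                            (Density.classes-nonempty G (r ∸ (k + 1)) (s≤s z≤n) dense)
                            (Density.dense-transversals G (r ∸ (k + 1)) (s≤s z≤n) dense) poor)
  where
  poor : ∀ T → Faces.Transversal G T → Counting.edge-faces G T ≤ suc (r ∸ (k + 1))
  poor T tr = subst (Counting.edge-faces G T ≤_) (∸-split-one (s≤s k≤r-1)) (≤-pred (≰⇒> (none T tr)))
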